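{- Let $G$ be a group and $\Omega_1,\Omega_2$ finite transitive $G$-sets, and let $\varphi:\mathbb{Z}\Omega_1\to\mathbb{Z}\Omega_2$ be an isomorphism of $\mathbb{Z}G$-modules. For $i=1,2$ let $\Delta_i:\mathbb{Z}\to\mathbb{Z}\Omega_i$, $n\mapsto n\sum_{\omega\in\Omega_i}\omega$, and $\varepsilon_i:\mathbb{Z}\Omega_i\to\mathbb{Z}$, $\sum_\omega n_\omega\omega\mapsto\sum_\omega n_\omega$. Then either $\varphi\circ\Delta_1=\Delta_2$ and $\varepsilon_2\circ\varphi=\varepsilon_1$, or $(-\varphi)\circ\Delta_1=\Delta_2$ and $\varepsilon_2\circ(-\varphi)=\varepsilon_1$. -}

module Defs where

open import Level using (Level; _⊔_)
open import Algebra.Bundles using (Group)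
open import Data.Nat using (ℕ)
open import Data.Fin using (Fin)
open import Data.Integer using (ℤ; _+_; -_) renaming (0ℤ to zeroℤ)
open import Data.Vec using (Vec; lookup; tabulate; zipWith; replicate; foldr; map)
open import Data.Product using (Σ; ∃; _×_)
open import Relation.Binary.PropositionalEquality using (_≡_)

record Action {c ℓ : Level} (G : Group c ℓ) (n : ℕ) : Set (c ⊔ ℓ) where
  open Group G
  field
    act      : Carrier → Fin n → Fin n
    act-cong : ∀ {g h} → g ≈ h → ∀ x → act g x ≡ act h x
    act-id   : ∀ x → act ε x ≡ x
    act-comp : ∀ g h x → act (g ∙ h) x ≡ act g (act h (x))

IsTransitive : {c ℓ : Level} {G : Group c ℓ} {n : ℕ} → Action G n → Set c
IsTransitive {G = G} {n} A = ∀ (x y : Fin n) → Σ (Group.Carrier G) λ g → Action.act A g x ≡ y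

-- The permutation module ℤΩ for Ω = Fin n: an element Σ_ω n_ω ω is the
-- coefficient vector (n_ω)_ω.
ℤΩ : ℕ → Set
ℤΩ n = Vec ℤ n

-- Induced ℤ-linear action of G on ℤΩ:  g · (Σ n_ω ω) = Σ n_ω (g ω),
-- i.e. the coefficient of ω in g·v is the coefficient of g⁻¹ω in v.
_·⟨_⟩_ : {c ℓ : Level} {G : Group c ℓ} {n : ℕ} →
         Group.Carrier G → Action G n → ℤΩ n → ℤΩ n
_·⟨_⟩_ {G = G} g A v = tabulate λ ω → lookup v (Action.act A (Group._⁻¹ G g) ω)

_⊕_ : {n : ℕ} → ℤΩ n → ℤΩ n → ℤΩ n
_⊕_ = zipWith _+_

-- ℤG-module homomorphism ℤΩ₁ → ℤΩ₂ (additive + G-equivariant; this is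
-- exactly ℤG-linearity since ℤG is spanned additively by G).
record IsZGHom {c ℓ : Level} {G : Group c ℓ} {n m : ℕ}
       (A : Action G n) (B : Action G m) (φ : ℤΩ n → ℤΩ m) : Set c where
  field
    additive    : ∀ v w → φ (v ⊕ w) ≡ φ v ⊕ φ w
    equivariant : ∀ g v → φ (g ·⟨ A ⟩ v) ≡ g ·⟨ B ⟩ φ v

record IsZGIso {c ℓ : Level} {G : Group c ℓ} {n m : ℕ}
       (A : Action G n) (B : Action G m) (φ : ℤΩ n → ℤΩ m) : Set c where
  field
    isHom   : IsZGHom A B φ
    inverse : ℤΩ m → ℤΩ n
    invˡ    : ∀ v → inverse (φ v) ≡ v
    invʳ    : ∀ w → φ (inverse w) ≡ w

Δ : (n : ℕ) → ℤ → ℤΩ n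
Δ n k = replicate n k

aug : {n : ℕ} → ℤΩ n → ℤ
aug = foldr _ _+_ zeroℤ

neg : {n m : ℕ} → (ℤΩ n → ℤΩ m) → ℤΩ n → ℤΩ m
neg φ v = map -_ (φ v)

{-# OPTIONS --safe #-}
-- For a transitive G-set Ω, the G-fixed vectors of ℤΩ are the constant ones, Δ(ℤ), and a
-- G-invariant additive functional ℤΩ → ℤ takes one value c on the whole basis Ω, so it is
-- c ε. Hence φ ∘ Δ₁ = Δ₂ ∘ s and ε₂ ∘ φ = c ε₁ for integers s and c, and both are units
-- because φ is invertible. Evaluating ε₂ (φ (Δ₁ 1)) in two ways gives c |Ω₁| = s |Ω₂|, so c
-- and s have the same sign: c = s = ±1.
module Submission where

open import Defs
open import Level using (Level)
open import Algebra.Bundles using (Group)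
open import Data.Nat using (ℕ; zero; suc)
import Data.Nat.Properties as ℕ
open import Data.Integer using (ℤ; +_; -[1+_]; 0ℤ; 1ℤ; -1ℤ; _+_; _*_; -_; ∣_∣)
import Data.Integer.Properties as ℤ
open import Data.Fin using (Fin; zero; suc; _≟_)
open import Data.Fin.Permutation using (permutation)
open import Data.Vec using (Vec; []; _∷_; lookup; replicate; map; _[_]≔_)
import Data.Vec.Properties as Vec
open import Data.Product using (Σ; _×_; _,_)
open import Data.Sum using (_⊎_; inj₁; inj₂)
open import Data.Empty using (⊥; ⊥-elim)
open import Relation.Nullary using (yes; no)
open import Relation.Binary.PropositionalEquality
  using (_≡_; _≢_; refl; sym; trans; cong; cong₂; module ≡-Reasoning)
open import Algebra.Properties.AbelianGroup ℤ.+-0-abelianGroup using (identityʳ-unique; inverseˡ-unique)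
open import Algebra.Properties.CommutativeSemigroup ℤ.+-commutativeSemigroup using (interchange)
import Algebra.Properties.CommutativeMonoid.Sum ℤ.+-0-commutativeMonoid as Σℤ

open ≡-Reasoning

IsUnit : ℤ → Set
IsUnit i = i ≡ 1ℤ ⊎ i ≡ -1ℤ

i*j≡1⇒isUnit : ∀ i j → i * j ≡ 1ℤ → IsUnit i
i*j≡1⇒isUnit i j eq with ℕ.m*n≡1⇒m≡1 ∣ i ∣ ∣ j ∣ (trans (sym (ℤ.abs-* i j)) (cong ∣_∣ eq))
i*j≡1⇒isUnit (+ .1)     _ _ | refl = inj₁ refl
i*j≡1⇒isUnit -[1+ .0 ] _ _ | refl = inj₂ refl

isUnit-*-suc-injective : ∀ {i j} a b → IsUnit i → IsUnit j → i * + suc a ≡ j * + suc b → i ≡ j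
isUnit-*-suc-injective _ _ (inj₁ refl) (inj₁ refl) _ = refl
isUnit-*-suc-injective _ _ (inj₂ refl) (inj₂ refl) _ = refl
isUnit-*-suc-injective _ _ (inj₁ refl) (inj₂ refl) ()
isUnit-*-suc-injective _ _ (inj₂ refl) (inj₁ refl) ()

additive⇒≡* : (F : ℤ → ℤ) → (∀ i j → F (i + j) ≡ F i + F j) → ∀ k → F k ≡ F 1ℤ * k
additive⇒≡* F F-+ = F≡*
  where
  F0≡0 : F 0ℤ ≡ 0ℤ
  F0≡0 = identityʳ-unique (F 0ℤ) (F 0ℤ) (sym (F-+ 0ℤ 0ℤ))

  F+≡* : ∀ n → F (+ n) ≡ F 1ℤ * + n
  F+≡* zero    = trans F0≡0 (sym (ℤ.*-zeroʳ (F 1ℤ)))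
  F+≡* (suc n) = begin
    F (1ℤ + + n)            ≡⟨ F-+ 1ℤ (+ n) ⟩
    F 1ℤ + F (+ n)          ≡⟨ cong (_+_ (F 1ℤ)) (F+≡* n) ⟩
    F 1ℤ + F 1ℤ * + n       ≡⟨ cong (_+ F 1ℤ * + n) (ℤ.*-identityʳ (F 1ℤ)) ⟨
    F 1ℤ * 1ℤ + F 1ℤ * + n  ≡⟨ ℤ.*-distribˡ-+ (F 1ℤ) 1ℤ (+ n) ⟨
    F 1ℤ * (1ℤ + + n)       ∎

  F≡* : ∀ k → F k ≡ F 1ℤ * k
  F≡* (+ n)    = F+≡* n
  F≡* -[1+ n ] = begin
    F -[1+ n ]             ≡⟨ inverseˡ-unique _ _ F-[1+n]+F[1+n]≡0 ⟩
    - F (+ suc n)          ≡⟨ cong -_ (F+≡* (suc n)) ⟩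
    - (F 1ℤ * + suc n)     ≡⟨ ℤ.neg-distribʳ-* (F 1ℤ) (+ suc n) ⟩
    F 1ℤ * -[1+ n ]        ∎
    where
    F-[1+n]+F[1+n]≡0 : F -[1+ n ] + F (+ suc n) ≡ 0ℤ
    F-[1+n]+F[1+n]≡0 = trans (sym (F-+ _ _)) (trans (cong F (ℤ.+-inverseˡ (+ suc n))) F0≡0)

lookup-ext : ∀ {A : Set} {n} {xs ys : Vec A n} → (∀ i → lookup xs i ≡ lookup ys i) → xs ≡ ys
lookup-ext {xs = xs} {ys} eq =
  trans (sym (Vec.tabulate∘lookup xs)) (trans (Vec.tabulate-cong eq) (Vec.tabulate∘lookup ys))

[]-unique : ∀ {A : Set} (xs : Vec A 0) → xs ≡ []
[]-unique [] = refl

basis : ∀ {n} → Fin n → ℤΩ n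
basis ω = replicate _ 0ℤ [ ω ]≔ 1ℤ

lookup-basis-self : ∀ {n} (ω : Fin n) → lookup (basis ω) ω ≡ 1ℤ
lookup-basis-self ω = Vec.lookup∘updateAt ω (replicate _ 0ℤ)

lookup-basis-≢ : ∀ {n} {x ω : Fin n} → x ≢ ω → lookup (basis ω) x ≡ 0ℤ
lookup-basis-≢ {x = x} {ω} x≢ω =
  trans (Vec.lookup∘updateAt′ x ω x≢ω (replicate _ 0ℤ)) (Vec.lookup-replicate x 0ℤ)

aug-⊕ : ∀ {n} (v w : ℤΩ n) → aug (v ⊕ w) ≡ aug v + aug w
aug-⊕ []      []      = refl
aug-⊕ (x ∷ v) (y ∷ w) = trans (cong (_+_ (x + y)) (aug-⊕ v w)) (interchange x y (aug v) (aug w))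

aug-neg : ∀ {n} (v : ℤΩ n) → aug (map -_ v) ≡ - aug v
aug-neg []      = refl
aug-neg (x ∷ v) = trans (cong (_+_ (- x)) (aug-neg v)) (sym (ℤ.neg-distrib-+ x (aug v)))

aug-Δ : ∀ n k → aug (Δ n k) ≡ k * + n
aug-Δ zero    k = sym (ℤ.*-zeroʳ k)
aug-Δ (suc n) k = begin
  k + aug (Δ n k)     ≡⟨ cong (_+_ k) (aug-Δ n k) ⟩
  k + k * + n         ≡⟨ cong (_+ k * + n) (ℤ.*-identityʳ k) ⟨
  k * 1ℤ + k * + n    ≡⟨ ℤ.*-distribˡ-+ k 1ℤ (+ n) ⟨
  k * + suc n         ∎

aug-basis-zero : ∀ n → aug (basis {suc n} zero) ≡ 1ℤ
aug-basis-zero n = cong (_+_ 1ℤ) (aug-Δ n 0ℤ)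

aug≡sum : ∀ {n} (v : ℤΩ n) → aug v ≡ Σℤ.sum (lookup v)
aug≡sum []      = refl
aug≡sum (x ∷ v) = cong (_+_ x) (aug≡sum v)

additive⇒≡*aug : ∀ {n} (L : ℤΩ n → ℤ) → (∀ v w → L (v ⊕ w) ≡ L v + L w) →
                 ∀ c → (∀ ω → L (basis ω) ≡ c) → ∀ v → L v ≡ c * aug v
additive⇒≡*aug L L-+ c L-basis [] =
  trans (identityʳ-unique (L []) (L []) (sym (L-+ [] []))) (sym (ℤ.*-zeroʳ c))
additive⇒≡*aug {suc n} L L-+ c L-basis (x ∷ v) = begin
  L (x ∷ v)                     ≡⟨ cong L x∷v≡head⊕tail ⟩
  L ((x ∷ zeros) ⊕ (0ℤ ∷ v))    ≡⟨ L-+ _ _ ⟩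
  F x + L (0ℤ ∷ v)              ≡⟨ cong (_+ L (0ℤ ∷ v)) (additive⇒≡* F F-+ x) ⟩
  F 1ℤ * x + L (0ℤ ∷ v)         ≡⟨ cong (λ a → a * x + L (0ℤ ∷ v)) (L-basis zero) ⟩
  c * x + L (0ℤ ∷ v)            ≡⟨ cong (_+_ (c * x)) tail-IH ⟩
  c * x + c * aug v             ≡⟨ ℤ.*-distribˡ-+ c x (aug v) ⟨
  c * (x + aug v)               ∎
  where
  zeros : ℤΩ n
  zeros = replicate n 0ℤ

  zeros⊕ : ∀ w → zeros ⊕ w ≡ w
  zeros⊕ w = trans (Vec.zipWith-replicate₁ _+_ 0ℤ w)
                   (trans (Vec.map-cong ℤ.+-identityˡ w) (Vec.map-id w))

  x∷v≡head⊕tail : x ∷ v ≡ (x ∷ zeros) ⊕ (0ℤ ∷ v)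
  x∷v≡head⊕tail = sym (cong₂ _∷_ (ℤ.+-identityʳ x) (zeros⊕ v))

  F : ℤ → ℤ
  F a = L (a ∷ zeros)

  F-+ : ∀ a b → F (a + b) ≡ F a + F b
  F-+ a b = trans (cong (λ u → L (a + b ∷ u)) (sym (zeros⊕ zeros))) (L-+ _ _)

  tail-IH : L (0ℤ ∷ v) ≡ c * aug v
  tail-IH = additive⇒≡*aug (λ w → L (0ℤ ∷ w)) (λ u w → L-+ (0ℤ ∷ u) (0ℤ ∷ w))
              c (λ ω → L-basis (suc ω)) v

ℤΩ0-cannot-retract-onto-ℤΩsuc : ∀ {m} (φ : ℤΩ 0 → ℤΩ (suc m)) (ψ : ℤΩ (suc m) → ℤΩ 0) →
                                (∀ w → φ (ψ w) ≡ w) → ⊥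
ℤΩ0-cannot-retract-onto-ℤΩsuc {m} φ ψ φψ≡id = 0≢1 (cong (λ w → lookup w zero) Δ0≡Δ1)
  where
  0≢1 : 0ℤ ≢ 1ℤ
  0≢1 ()

  Δ0≡Δ1 : Δ (suc m) 0ℤ ≡ Δ (suc m) 1ℤ
  Δ0≡Δ1 = trans (sym (φψ≡id _))
            (trans (cong φ (trans ([]-unique _) (sym ([]-unique _)))) (φψ≡id _))

module _ {c ℓ : Level} {G : Group c ℓ} {n : ℕ} (A : Action G n) where
  open Group G using (_⁻¹; inverseˡ; inverseʳ)
  open Action A

  act-act⁻¹ : ∀ h x → act h (act (h ⁻¹) x) ≡ x
  act-act⁻¹ h x = trans (sym (act-comp h (h ⁻¹) x)) (trans (act-cong (inverseʳ h) x) (act-id x))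

  act⁻¹-act : ∀ h x → act (h ⁻¹) (act h x) ≡ x
  act⁻¹-act h x = trans (sym (act-comp (h ⁻¹) h x)) (trans (act-cong (inverseˡ h) x) (act-id x))

  lookup-· : ∀ h v x → lookup (h ·⟨ A ⟩ v) x ≡ lookup v (act (h ⁻¹) x)
  lookup-· h v = Vec.lookup∘tabulate (λ x → lookup v (act (h ⁻¹) x))

  ·-Δ : ∀ h k → h ·⟨ A ⟩ Δ n k ≡ Δ n k
  ·-Δ h k = lookup-ext λ x → begin
    lookup (h ·⟨ A ⟩ Δ n k) x     ≡⟨ lookup-· h (Δ n k) x ⟩
    lookup (Δ n k) (act (h ⁻¹) x) ≡⟨ Vec.lookup-replicate (act (h ⁻¹) x) k ⟩
    k                             ≡⟨ Vec.lookup-replicate x k ⟨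
    lookup (Δ n k) x              ∎

  ·-basis : ∀ h ω → h ·⟨ A ⟩ basis ω ≡ basis (act h ω)
  ·-basis h ω = lookup-ext λ x → trans (lookup-· h (basis ω) x) (pointwise x)
    where
    pointwise : ∀ x → lookup (basis ω) (act (h ⁻¹) x) ≡ lookup (basis (act h ω)) x
    pointwise x with x ≟ act h ω
    ... | yes refl = trans (cong (lookup (basis ω)) (act⁻¹-act h ω))
                           (trans (lookup-basis-self ω) (sym (lookup-basis-self (act h ω))))
    ... | no x≢hω  = trans (lookup-basis-≢ h⁻¹x≢ω) (sym (lookup-basis-≢ x≢hω))
      where
      h⁻¹x≢ω : act (h ⁻¹) x ≢ ω
      h⁻¹x≢ω eq = x≢hω (trans (sym (act-act⁻¹ h x)) (cong (act h) eq))

  aug-· : ∀ h v → aug (h ·⟨ A ⟩ v) ≡ aug v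
  aug-· h v = begin
    aug (h ·⟨ A ⟩ v)                           ≡⟨ aug≡sum (h ·⟨ A ⟩ v) ⟩
    Σℤ.sum (lookup (h ·⟨ A ⟩ v))               ≡⟨ Σℤ.sum-cong-≗ (lookup-· h v) ⟩
    Σℤ.sum (λ x → lookup v (act (h ⁻¹) x))     ≡⟨ Σℤ.sum-permute (lookup v) π ⟨
    Σℤ.sum (lookup v)                          ≡⟨ aug≡sum v ⟨
    aug v                                      ∎
    where π = permutation (act (h ⁻¹)) (act h) (act⁻¹-act h) (act-act⁻¹ h)

  module _ (transitive : IsTransitive A) where

    invariant⇒≡Δ : ∀ {v} → (∀ h → h ·⟨ A ⟩ v ≡ v) → ∀ x₀ → v ≡ Δ n (lookup v x₀)
    invariant⇒≡Δ {v} v-inv x₀ = lookup-ext pointwise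
      where
      pointwise : ∀ x → lookup v x ≡ lookup (Δ n (lookup v x₀)) x
      pointwise x with transitive x₀ x
      ... | h , refl = begin
        lookup v (act h x₀)                   ≡⟨ cong (λ u → lookup u (act h x₀)) (v-inv h) ⟨
        lookup (h ·⟨ A ⟩ v) (act h x₀)        ≡⟨ lookup-· h v (act h x₀) ⟩
        lookup v (act (h ⁻¹) (act h x₀))      ≡⟨ cong (lookup v) (act⁻¹-act h x₀) ⟩
        lookup v x₀                           ≡⟨ Vec.lookup-replicate (act h x₀) (lookup v x₀) ⟨
        lookup (Δ n (lookup v x₀)) (act h x₀) ∎

    invariant-constant-on-basis : (L : ℤΩ n → ℤ) → (∀ h v → L (h ·⟨ A ⟩ v) ≡ L v) →
                                  ∀ ω₀ ω → L (basis ω) ≡ L (basis ω₀)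
    invariant-constant-on-basis L L-inv ω₀ ω with transitive ω₀ ω
    ... | h , refl = trans (cong L (sym (·-basis h ω₀))) (L-inv h (basis ω₀))

module _ {c ℓ : Level} {G : Group c ℓ} {n m : ℕ} {A : Action G n} {B : Action G m}
         {φ : ℤΩ n → ℤΩ m} where

  inverse-isZGHom : (iso : IsZGIso A B φ) → IsZGHom B A (IsZGIso.inverse iso)
  inverse-isZGHom iso = record { additive = ψ-additive ; equivariant = ψ-equivariant }
    where
    open IsZGIso iso renaming (inverse to ψ)
    open IsZGHom isHom

    ψ-additive : ∀ v w → ψ (v ⊕ w) ≡ ψ v ⊕ ψ w
    ψ-additive v w = begin
      ψ (v ⊕ w)               ≡⟨ cong (λ u → ψ (u ⊕ w)) (invʳ v) ⟨
      ψ (φ (ψ v) ⊕ w)         ≡⟨ cong (λ u → ψ (φ (ψ v) ⊕ u)) (invʳ w) ⟨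
      ψ (φ (ψ v) ⊕ φ (ψ w))   ≡⟨ cong ψ (additive (ψ v) (ψ w)) ⟨
      ψ (φ (ψ v ⊕ ψ w))       ≡⟨ invˡ _ ⟩
      ψ v ⊕ ψ w               ∎

    ψ-equivariant : ∀ h w → ψ (h ·⟨ B ⟩ w) ≡ h ·⟨ A ⟩ ψ w
    ψ-equivariant h w = begin
      ψ (h ·⟨ B ⟩ w)          ≡⟨ cong (λ u → ψ (h ·⟨ B ⟩ u)) (invʳ w) ⟨
      ψ (h ·⟨ B ⟩ φ (ψ w))    ≡⟨ cong ψ (equivariant h (ψ w)) ⟨
      ψ (φ (h ·⟨ A ⟩ ψ w))    ≡⟨ invˡ _ ⟩
      h ·⟨ A ⟩ ψ w            ∎

  module _ (hom : IsZGHom A B φ) where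
    open IsZGHom hom

    hom∘Δ : IsTransitive B → ∀ ω₀ k → φ (Δ n k) ≡ Δ m (lookup (φ (Δ n 1ℤ)) ω₀ * k)
    hom∘Δ transitive ω₀ k = begin
      φ (Δ n k)       ≡⟨ invariant⇒≡Δ B transitive φΔ-invariant ω₀ ⟩
      Δ m (f k)       ≡⟨ cong (Δ m) (additive⇒≡* f f-+ k) ⟩
      Δ m (f 1ℤ * k)  ∎
      where
      f : ℤ → ℤ
      f k = lookup (φ (Δ n k)) ω₀

      f-+ : ∀ i j → f (i + j) ≡ f i + f j
      f-+ i j = begin
        lookup (φ (Δ n (i + j))) ω₀             ≡⟨ cong (λ v → lookup (φ v) ω₀) (Vec.zipWith-replicate _+_ i j) ⟨
        lookup (φ (Δ n i ⊕ Δ n j)) ω₀           ≡⟨ cong (λ v → lookup v ω₀) (additive _ _) ⟩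
        lookup (φ (Δ n i) ⊕ φ (Δ n j)) ω₀       ≡⟨ Vec.lookup-zipWith _+_ ω₀ (φ (Δ n i)) (φ (Δ n j)) ⟩
        f i + f j                               ∎

      φΔ-invariant : ∀ h → h ·⟨ B ⟩ φ (Δ n k) ≡ φ (Δ n k)
      φΔ-invariant h = trans (sym (equivariant h (Δ n k))) (cong φ (·-Δ A h k))

    aug∘hom : IsTransitive A → ∀ ω₀ v → aug (φ v) ≡ aug (φ (basis ω₀)) * aug v
    aug∘hom transitive ω₀ =
      additive⇒≡*aug L L-+ (L (basis ω₀)) (invariant-constant-on-basis A transitive L L-inv ω₀)
      where
      L : ℤΩ n → ℤ
      L v = aug (φ v)

      L-+ : ∀ v w → L (v ⊕ w) ≡ L v + L w
      L-+ v w = trans (cong aug (additive v w)) (aug-⊕ (φ v) (φ w))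

      L-inv : ∀ h v → L (h ·⟨ A ⟩ v) ≡ L v
      L-inv h v = trans (cong aug (equivariant h v)) (aug-· B h (φ v))

isZGIso⇒unit-scalar : {c ℓ : Level} {G : Group c ℓ} {n m : ℕ}
                      {A : Action G (suc n)} {B : Action G (suc m)} →
                      IsTransitive A → IsTransitive B →
                      {φ : ℤΩ (suc n) → ℤΩ (suc m)} → IsZGIso A B φ →
                      Σ ℤ λ s → IsUnit s × (∀ k → φ (Δ (suc n) k) ≡ Δ (suc m) (s * k))
                                          × (∀ v → aug (φ v) ≡ s * aug v)
isZGIso⇒unit-scalar {n = n} {m} tA tB {φ} iso =
  s , s-unit , φ∘Δ , λ v → trans (aug∘φ v) (cong (_* aug v) c≡s)
  where
  open IsZGIso iso renaming (inverse to ψ)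

  ψ-hom : IsZGHom _ _ ψ
  ψ-hom = inverse-isZGHom iso

  s t c : ℤ
  s = lookup (φ (Δ (suc n) 1ℤ)) zero
  t = lookup (ψ (Δ (suc m) 1ℤ)) zero
  c = aug (φ (basis zero))

  φ∘Δ : ∀ k → φ (Δ (suc n) k) ≡ Δ (suc m) (s * k)
  φ∘Δ = hom∘Δ isHom tB zero

  aug∘φ : ∀ v → aug (φ v) ≡ c * aug v
  aug∘φ = aug∘hom isHom tA zero

  s-unit : IsUnit s
  s-unit = i*j≡1⇒isUnit s (t * 1ℤ) (sym (cong (λ w → lookup w zero) (begin
    Δ (suc m) 1ℤ                ≡⟨ invʳ _ ⟨
    φ (ψ (Δ (suc m) 1ℤ))        ≡⟨ cong φ (hom∘Δ ψ-hom tA zero 1ℤ) ⟩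
    φ (Δ (suc n) (t * 1ℤ))      ≡⟨ φ∘Δ (t * 1ℤ) ⟩
    Δ (suc m) (s * (t * 1ℤ))    ∎)))

  c-unit : IsUnit c
  c-unit = i*j≡1⇒isUnit c (aug (ψ (basis zero))) (begin
    c * aug (ψ (basis zero))    ≡⟨ aug∘φ _ ⟨
    aug (φ (ψ (basis zero)))    ≡⟨ cong aug (invʳ (basis zero)) ⟩
    aug (basis {suc m} zero)    ≡⟨ aug-basis-zero m ⟩
    1ℤ                          ∎)

  c≡s : c ≡ s
  c≡s = isUnit-*-suc-injective n m c-unit s-unit (begin
    c * + suc n                 ≡⟨ cong (c *_) (ℤ.*-identityˡ _) ⟨
    c * (1ℤ * + suc n)          ≡⟨ cong (c *_) (aug-Δ (suc n) 1ℤ) ⟨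
    c * aug (Δ (suc n) 1ℤ)      ≡⟨ aug∘φ _ ⟨
    aug (φ (Δ (suc n) 1ℤ))      ≡⟨ cong aug (φ∘Δ 1ℤ) ⟩
    aug (Δ (suc m) (s * 1ℤ))    ≡⟨ aug-Δ (suc m) (s * 1ℤ) ⟩
    s * 1ℤ * + suc m            ≡⟨ cong (_* + suc m) (ℤ.*-identityʳ s) ⟩
    s * + suc m                 ∎)

lemma5p1 : {c ℓ : Level} (G : Group c ℓ) (n₁ n₂ : ℕ)
           (A₁ : Action G n₁) (A₂ : Action G n₂) →
           IsTransitive A₁ → IsTransitive A₂ →
           (φ : ℤΩ n₁ → ℤΩ n₂) → IsZGIso A₁ A₂ φ →
           ((∀ (k : ℤ) → φ (Δ n₁ k) ≡ Δ n₂ k) × (∀ v → aug (φ v) ≡ aug v))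
           ⊎ ((∀ (k : ℤ) → neg φ (Δ n₁ k) ≡ Δ n₂ k) × (∀ v → aug (neg φ v) ≡ aug v))
lemma5p1 _ zero zero _ _ _ _ φ _ =
  inj₁ ((λ _ → []-unique (φ [])) , λ v → cong aug (trans ([]-unique (φ v)) (sym ([]-unique v))))
lemma5p1 _ zero (suc _) _ _ _ _ φ iso =
  ⊥-elim (ℤΩ0-cannot-retract-onto-ℤΩsuc φ (IsZGIso.inverse iso) (IsZGIso.invʳ iso))
lemma5p1 _ (suc _) zero _ _ _ _ φ iso =
  ⊥-elim (ℤΩ0-cannot-retract-onto-ℤΩsuc (IsZGIso.inverse iso) φ (IsZGIso.invˡ iso))
lemma5p1 _ (suc n) (suc m) _ _ t₁ t₂ φ iso with isZGIso⇒unit-scalar t₁ t₂ iso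
... | _ , inj₁ refl , φ∘Δ , aug∘φ =
  inj₁ ((λ k → trans (φ∘Δ k) (cong (Δ (suc m)) (ℤ.*-identityˡ k))) ,
        (λ v → trans (aug∘φ v) (ℤ.*-identityˡ (aug v))))
... | _ , inj₂ refl , φ∘Δ , aug∘φ =
  inj₂ ((λ k → begin
          map -_ (φ (Δ (suc n) k))          ≡⟨ cong (map -_) (φ∘Δ k) ⟩
          map -_ (Δ (suc m) (-1ℤ * k))      ≡⟨ Vec.map-replicate -_ (-1ℤ * k) (suc m) ⟩
          Δ (suc m) (- (-1ℤ * k))           ≡⟨ cong (Δ (suc m)) (-[-1*i]≡i k) ⟩
          Δ (suc m) k                       ∎) ,
        (λ v → trans (aug-neg (φ v)) (trans (cong -_ (aug∘φ v)) (-[-1*i]≡i (aug v)))))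
  where
  -[-1*i]≡i : ∀ i → - (-1ℤ * i) ≡ i
  -[-1*i]≡i i = trans (cong -_ (ℤ.-1*i≡-i i)) (ℤ.neg-involutive i)
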